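{- Let $k,t\geq 2$ be integers and let $n$ be an integer with $2t\leq n\leq 3t$. Let $\beta_k(t)=k-(k-1)k^{ -t-1}$. Then $A_k(n,0^t)\leq \beta_k(t)^n$.
   Context: $A_k(m,v)$ is the number of length-$m$ words over $\Sigma_k=\{0,1,\ldots,k-1\}$ that do not contain $v$ as a factor; $0^t$ is the word of $t$ zeros. -}

module Defs where

open import Data.Nat using (ℕ; zero; suc; _+_; _∸_; _^_)
open import Data.Nat.Properties using (m^n≢0; _≟_)
open import Data.Integer using (+_)
open import Data.List using (List; []; _∷_; map; concatMap; filter; length; upTo; replicate)
open import Data.List.Relation.Binary.Infix.Heterogeneous.Properties using (infix?)
open import Data.Rational using (ℚ; 0ℚ; 1ℚ; _/_; _-_; _*_)

open import Relation.Nullary using (¬?)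

-- Σ_k = {0,1,…,k-1}, letters represented as natural numbers.
-- allWords k m : list of all length-m words over Σ_k (each exactly once).
allWords : ℕ → ℕ → List (List ℕ)
allWords k zero    = [] ∷ []
allWords k (suc m) = concatMap (λ a → map (a ∷_) (allWords k m)) (upTo k)

A : ℕ → ℕ → List ℕ → ℕ
A k m v = length (filter (λ w → ¬? (infix? _≟_ v w)) (allWords k m))

zeros : ℕ → List ℕ
zeros t = replicate t 0

_^ℚ_ : ℚ → ℕ → ℚ
x ^ℚ zero  = 1ℚ
x ^ℚ suc n = x * (x ^ℚ n)

-- k^(-e) as a rational (junk value 0 for k = 0, never used since k ≥ 2)
invPow : ℕ → ℕ → ℚ
invPow zero    e = 0ℚ
invPow (suc k) e = (+ 1) / (suc k ^ e)
  where instance _ = m^n≢0 (suc k) e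

β : ℕ → ℕ → ℚ
β k t = (+ k) / 1 - ((+ (k ∸ 1)) / 1) * invPow k (t + 1)

ℕtoℚ : ℕ → ℚ
ℕtoℚ m = (+ m) / 1

module Submission where

-- Write aₘ = A_k(m,0ᵗ), bₘ = kᵐ − aₘ for the number of words containing 0ᵗ, and d = k − 1.
-- Sorting words by their first letter, while remembering how many zeros have just been read,
-- gives aₘ = kᵐ for m < t and a_{m+1+t} + d aₘ = k a_{m+t}, i.e. b_{m+1+t} = k b_{m+t} + d aₘ.
-- This recurrence first yields the union bound b_{t+i} ≤ (i+1)kⁱ, hence a_{t+i} ≥ k^{t+i−1}
-- for i < t; fed back in it gives k² b_{2t+i} ≥ (2t+i) d k^{t+i} for i ≤ t, which is where
-- n ≤ 3t is used. With K = k^{t+1} we have β = (kK − d)/K, and the Bernoulli-type estimate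
-- (kK)ⁿ⁺¹ ≤ kK (kK − d)ⁿ + n d (kK)ⁿ turns the lower bound on bₙ into Kⁿ aₙ ≤ (kK − d)ⁿ.

open import Defs
open import Data.Nat
open import Data.Nat.Properties
open import Data.Nat.Tactic.RingSolver using (solve-∀)
import Data.Integer as ℤ
import Data.Integer.Properties as ℤ
open import Data.Rational as ℚ using (1ℚ; toℚᵘ; Positive) renaming (_≤_ to _≤ℚ_)
open import Data.Rational.Properties as ℚ
  using (toℚᵘ-injective; toℚᵘ-fromℚᵘ; toℚᵘ-homo-*; toℚᵘ-cancel-≤; normalize-pos; *-cancelʳ-≤-pos)
open import Data.Rational.Solver using (module +-*-Solver)
open import Data.Rational.Unnormalised as ℚᵘ using (ℚᵘ; mkℚᵘ; *≡*; *≤*)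
import Data.Rational.Unnormalised.Properties as ℚᵘ
open import Data.List using (List; []; _∷_; _++_; map; concatMap; filter; length; applyUpTo)
open import Data.List.Properties
  using (length-++; length-map; length-replicate; filter-++; filter-≐; filter-accept; filter-none; ++-identityʳ)
open import Data.List.Relation.Unary.All using (universal)
open import Data.List.Relation.Binary.Infix.Heterogeneous using (Infix; here; there; _++ⁱ_; _ⁱ++_)
open import Data.List.Relation.Binary.Infix.Heterogeneous.Properties using (infix?)
import Data.List.Relation.Binary.Infix.Heterogeneous.Properties as Infix
open import Data.List.Relation.Binary.Prefix.Heterogeneous using (Prefix; _∷_)
open import Data.Bool using (true; false)
open import Data.Product using (_,_)
open import Function using (_∘_)
open import Relation.Nullary using (¬_; does; yes; no; ¬?; contradiction)
open import Relation.Unary using (Decidable; _≐_)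
open import Relation.Binary.PropositionalEquality
open import Algebra.Properties.CommutativeSemigroup +-commutativeSemigroup using (xy∙z≈xz∙y; xy∙z≈x∙zy)
open +-*-Solver using (solve; _:=_; _:+_; _:-_; _:*_; con)

module _ {A : Set} {P : A → Set} (P? : Decidable P) where

  filter-concatMap : {B : Set} (f : B → List A) (xs : List B) →
                     filter P? (concatMap f xs) ≡ concatMap (filter P? ∘ f) xs
  filter-concatMap f []       = refl
  filter-concatMap f (x ∷ xs) =
    trans (filter-++ P? (f x) (concatMap f xs)) (cong (filter P? (f x) ++_) (filter-concatMap f xs))

  length-filter-map : {B : Set} (f : B → A) (xs : List B) →
                      length (filter P? (map f xs)) ≡ length (filter (P? ∘ f) xs)
  length-filter-map f []       = refl
  length-filter-map f (x ∷ xs) with does (P? (f x))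
  ... | true  = cong suc (length-filter-map f xs)
  ... | false = length-filter-map f xs

  length-filter-++ : (xs ys : List A) →
                     length (filter P? (xs ++ ys)) ≡ length (filter P? xs) + length (filter P? ys)
  length-filter-++ xs ys = trans (cong length (filter-++ P? xs ys)) (length-++ (filter P? xs))

  length-filter-¬?+length-filter : (xs : List A) →
                     length (filter (¬? ∘ P?) xs) + length (filter P? xs) ≡ length xs
  length-filter-¬?+length-filter []       = refl
  length-filter-¬?+length-filter (x ∷ xs) with P? x
  ... | yes _ = trans (+-suc _ _) (cong suc (length-filter-¬?+length-filter xs))
  ... | no  _ = cong suc (length-filter-¬?+length-filter xs)

length-concatMap-applyUpTo : {A B : Set} (f : B → List A) (g : ℕ → B) (c : ℕ) →
                             (∀ i → length (f (g i)) ≡ c) →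
                             ∀ n → length (concatMap f (applyUpTo g n)) ≡ n * c
length-concatMap-applyUpTo f g c len zero    = refl
length-concatMap-applyUpTo f g c len (suc n) =
  trans (length-++ (f (g 0))) (cong₂ _+_ (len 0) (length-concatMap-applyUpTo f (g ∘ suc) c (len ∘ suc) n))

length-allWords : ∀ k m → length (allWords k m) ≡ k ^ m
length-allWords k zero    = refl
length-allWords k (suc m) =
  length-concatMap-applyUpTo (λ a → map (a ∷_) (allWords k m)) (λ i → i) (k ^ m)
    (λ a → trans (length-map (a ∷_) (allWords k m)) (length-allWords k m)) k

n<m^n : ∀ {m} → 1 < m → ∀ n → n < m ^ n
n<m^n 1<m zero        = s≤s z≤n
n<m^n {m} 1<m (suc n) = begin
  2 + n          ≤⟨ +-mono-≤ (≤-trans (s≤s z≤n) n<m^n′) n<m^n′ ⟩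
  m ^ n + m ^ n  ≡⟨ cong (m ^ n +_) (sym (+-identityʳ (m ^ n))) ⟩
  2 * m ^ n      ≤⟨ *-monoˡ-≤ (m ^ n) 1<m ⟩
  m ^ suc n      ∎
  where
  open ≤-Reasoning
  n<m^n′ = n<m^n 1<m n

n*m≤m^n : ∀ {m} → 1 < m → ∀ n → n * m ≤ m ^ n
n*m≤m^n 1<m zero        = z≤n
n*m≤m^n {m} 1<m (suc n) = ≤-trans (*-monoˡ-≤ m (n<m^n 1<m n)) (≤-reflexive (*-comm (m ^ n) m))

linear-growth : ∀ (x : ℕ → ℕ) k c J → (∀ j → j < J → k * x j + c * k ^ suc j ≤ x (suc j)) →
                ∀ j → j ≤ J → k ^ j * x 0 + j * c * k ^ j ≤ x j
linear-growth x k c J step zero    _   = ≤-reflexive (trans (+-identityʳ _) (+-identityʳ (x 0)))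
linear-growth x k c J step (suc j) j<J = begin
  k ^ suc j * x 0 + suc j * c * k ^ suc j          ≡⟨ regroup k (k ^ j) (x 0) j c ⟩
  k * (k ^ j * x 0 + j * c * k ^ j) + c * k ^ suc j ≤⟨ +-monoˡ-≤ _ (*-monoʳ-≤ k previous) ⟩
  k * x j + c * k ^ suc j                            ≤⟨ step j j<J ⟩
  x (suc j)                                          ∎
  where
  open ≤-Reasoning
  previous = linear-growth x k c J step j (<⇒≤ j<J)
  regroup : ∀ k p x₀ j c → k * p * x₀ + suc j * c * (k * p) ≡ k * (p * x₀ + j * c * p) + c * (k * p)
  regroup = solve-∀

^-distribʳ-* : ∀ m n o → (m * n) ^ o ≡ m ^ o * n ^ o
^-distribʳ-* m n zero    = refl
^-distribʳ-* m n (suc o) = trans (cong (m * n *_) (^-distribʳ-* m n o)) (interchange m n (m ^ o) (n ^ o))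
  where
  interchange : ∀ m n p q → m * n * (p * q) ≡ m * p * (n * q)
  interchange = solve-∀

+-^-suc-≤ : ∀ x y n → (x + y) ^ suc n ≤ (x + y) * x ^ n + n * y * (x + y) ^ n
+-^-suc-≤ x y zero    = ≤-reflexive (sym (+-identityʳ _))
+-^-suc-≤ x y (suc n) = begin
  (x + y) * (x + y) ^ suc n                                        ≤⟨ *-monoʳ-≤ (x + y) (+-^-suc-≤ x y n) ⟩
  (x + y) * ((x + y) * x ^ n + n * y * (x + y) ^ n)                ≡⟨ expand x y n (x ^ n) ((x + y) ^ n) ⟩
  (x + y) * (x * x ^ n) + y * ((x + y) * x ^ n) + n * y * (x + y) ^ suc n
     ≤⟨ +-monoˡ-≤ (n * y * (x + y) ^ suc n) (+-monoʳ-≤ ((x + y) * (x * x ^ n)) enlarge) ⟩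
  (x + y) * (x * x ^ n) + y * (x + y) ^ suc n + n * y * (x + y) ^ suc n ≡⟨ collect x y n (x * x ^ n) ((x + y) ^ suc n) ⟩
  (x + y) * x ^ suc n + suc n * y * (x + y) ^ suc n               ∎
  where
  open ≤-Reasoning
  enlarge : y * ((x + y) * x ^ n) ≤ y * (x + y) ^ suc n
  enlarge = *-monoʳ-≤ y (*-monoʳ-≤ (x + y) (^-monoˡ-≤ n (m≤m+n x y)))
  expand : ∀ x y n p q → (x + y) * ((x + y) * p + n * y * q)
                       ≡ (x + y) * (x * p) + y * ((x + y) * p) + n * y * ((x + y) * q)
  expand = solve-∀
  collect : ∀ x y n p q → (x + y) * p + y * q + n * y * q ≡ (x + y) * p + suc n * y * q
  collect = solve-∀

power-bound : ∀ {a b k K M d} n .{{_ : NonZero k}} .{{_ : NonZero K}} →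
              a + b ≡ k ^ n → M + d ≡ k * K → n * d * k ^ n ≤ b * (k * K) → a * K ^ n ≤ M ^ n
power-bound {a} {b} {k} {K} {M} {d} n a+b≡k^n M+d≡S deficit =
  *-cancelˡ-≤ S (+-cancelʳ-≤ (n * d * S ^ n) (S * (a * K ^ n)) (S * M ^ n) (begin
    S * (a * K ^ n) + n * d * S ^ n      ≤⟨ +-monoʳ-≤ (S * (a * K ^ n)) scaled-deficit ⟩
    S * (a * K ^ n) + b * S * K ^ n      ≡⟨ factor S a b (K ^ n) ⟩
    S * ((a + b) * K ^ n)                ≡⟨ cong (λ y → S * (y * K ^ n)) a+b≡k^n ⟩
    S * (k ^ n * K ^ n)                  ≡⟨ cong (S *_) (sym (^-distribʳ-* k K n)) ⟩
    S ^ suc n                            ≡⟨ cong (_^ suc n) (sym M+d≡S) ⟩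
    (M + d) ^ suc n                      ≤⟨ +-^-suc-≤ M d n ⟩
    (M + d) * M ^ n + n * d * (M + d) ^ n ≡⟨ cong (λ y → y * M ^ n + n * d * y ^ n) M+d≡S ⟩
    S * M ^ n + n * d * S ^ n            ∎))
  where
  open ≤-Reasoning
  S = k * K
  instance _ = m*n≢0 k K
  factor : ∀ S a b q → S * (a * q) + b * S * q ≡ S * ((a + b) * q)
  factor = solve-∀
  scaled-deficit : n * d * S ^ n ≤ b * S * K ^ n
  scaled-deficit = begin
    n * d * S ^ n              ≡⟨ cong (n * d *_) (^-distribʳ-* k K n) ⟩
    n * d * (k ^ n * K ^ n)    ≡⟨ sym (*-assoc (n * d) (k ^ n) (K ^ n)) ⟩
    n * d * k ^ n * K ^ n      ≤⟨ *-monoˡ-≤ (K ^ n) deficit ⟩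
    b * S * K ^ n              ∎

ℕtoℚᵘ : ℕ → ℚᵘ
ℕtoℚᵘ m = mkℚᵘ (ℤ.+ m) 0

toℚᵘ-ℕtoℚ : ∀ m → toℚᵘ (ℕtoℚ m) ℚᵘ.≃ ℕtoℚᵘ m
toℚᵘ-ℕtoℚ m = toℚᵘ-fromℚᵘ (ℕtoℚᵘ m)

ℕtoℚ-homo-* : ∀ m n → ℕtoℚ (m * n) ≡ ℕtoℚ m ℚ.* ℕtoℚ n
ℕtoℚ-homo-* m n = toℚᵘ-injective (begin
  toℚᵘ (ℕtoℚ (m * n))                ≈⟨ toℚᵘ-ℕtoℚ (m * n) ⟩
  ℕtoℚᵘ (m * n)                       ≈⟨ *≡* (cong (ℤ._* ℤ.+ 1) (ℤ.pos-* m n)) ⟩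
  ℕtoℚᵘ m ℚᵘ.* ℕtoℚᵘ n                ≈⟨ ℚᵘ.≃-sym (ℚᵘ.*-cong (toℚᵘ-ℕtoℚ m) (toℚᵘ-ℕtoℚ n)) ⟩
  toℚᵘ (ℕtoℚ m) ℚᵘ.* toℚᵘ (ℕtoℚ n)    ≈⟨ ℚᵘ.≃-sym (toℚᵘ-homo-* (ℕtoℚ m) (ℕtoℚ n)) ⟩
  toℚᵘ (ℕtoℚ m ℚ.* ℕtoℚ n)            ∎)
  where open ℚᵘ.≃-Reasoning

ℕtoℚ-homo-+ : ∀ m n → ℕtoℚ (m + n) ≡ ℕtoℚ m ℚ.+ ℕtoℚ n
ℕtoℚ-homo-+ m n = toℚᵘ-injective (begin
  toℚᵘ (ℕtoℚ (m + n))                ≈⟨ toℚᵘ-ℕtoℚ (m + n) ⟩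
  ℕtoℚᵘ (m + n)                       ≈⟨ *≡* (cong (ℤ._* ℤ.+ 1) (trans (ℤ.pos-+ m n) (sym +m*1+n*1≡m+n))) ⟩
  ℕtoℚᵘ m ℚᵘ.+ ℕtoℚᵘ n                ≈⟨ ℚᵘ.≃-sym (ℚᵘ.+-cong (toℚᵘ-ℕtoℚ m) (toℚᵘ-ℕtoℚ n)) ⟩
  toℚᵘ (ℕtoℚ m) ℚᵘ.+ toℚᵘ (ℕtoℚ n)    ≈⟨ ℚᵘ.≃-sym (ℚ.toℚᵘ-homo-+ (ℕtoℚ m) (ℕtoℚ n)) ⟩
  toℚᵘ (ℕtoℚ m ℚ.+ ℕtoℚ n)            ∎)
  where
  open ℚᵘ.≃-Reasoning
  +m*1+n*1≡m+n : ℤ.+ m ℤ.* ℤ.+ 1 ℤ.+ ℤ.+ n ℤ.* ℤ.+ 1 ≡ ℤ.+ m ℤ.+ ℤ.+ n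
  +m*1+n*1≡m+n = cong₂ ℤ._+_ (ℤ.*-identityʳ (ℤ.+ m)) (ℤ.*-identityʳ (ℤ.+ n))

ℕtoℚ-mono-≤ : ∀ {m n} → m ≤ n → ℕtoℚ m ≤ℚ ℕtoℚ n
ℕtoℚ-mono-≤ {m} {n} m≤n = toℚᵘ-cancel-≤
  (ℚᵘ.≤-respˡ-≃ (ℚᵘ.≃-sym (toℚᵘ-ℕtoℚ m)) (ℚᵘ.≤-respʳ-≃ (ℚᵘ.≃-sym (toℚᵘ-ℕtoℚ n))
    (*≤* (subst₂ ℤ._≤_ (sym (ℤ.*-identityʳ (ℤ.+ m))) (sym (ℤ.*-identityʳ (ℤ.+ n))) (ℤ.+≤+ m≤n)))))

ℕtoℚ-*-1/ : ∀ n .{{_ : NonZero n}} → ℕtoℚ n ℚ.* (ℤ.+ 1 ℚ./ n) ≡ 1ℚ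
ℕtoℚ-*-1/ (suc n) = toℚᵘ-injective (begin
  toℚᵘ (ℕtoℚ (suc n) ℚ.* (ℤ.+ 1 ℚ./ suc n))         ≈⟨ toℚᵘ-homo-* (ℕtoℚ (suc n)) (ℤ.+ 1 ℚ./ suc n) ⟩
  toℚᵘ (ℕtoℚ (suc n)) ℚᵘ.* toℚᵘ (ℤ.+ 1 ℚ./ suc n)   ≈⟨ ℚᵘ.*-cong (toℚᵘ-ℕtoℚ (suc n)) (toℚᵘ-fromℚᵘ (mkℚᵘ (ℤ.+ 1) n)) ⟩
  ℕtoℚᵘ (suc n) ℚᵘ.* mkℚᵘ (ℤ.+ 1) n                 ≈⟨ ℚᵘ.*-inverseʳ (ℕtoℚᵘ (suc n)) ⟩
  toℚᵘ 1ℚ                                           ∎)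
  where open ℚᵘ.≃-Reasoning

^ℚ-distrib-* : ∀ p q n → (p ℚ.* q) ^ℚ n ≡ p ^ℚ n ℚ.* q ^ℚ n
^ℚ-distrib-* p q zero    = refl
^ℚ-distrib-* p q (suc n) = trans (cong (p ℚ.* q ℚ.*_) (^ℚ-distrib-* p q n))
  (solve 4 (λ p q x y → p :* q :* (x :* y) := p :* x :* (q :* y)) refl p q (p ^ℚ n) (q ^ℚ n))

ℕtoℚ-homo-^ : ∀ m n → ℕtoℚ (m ^ n) ≡ ℕtoℚ m ^ℚ n
ℕtoℚ-homo-^ m zero    = refl
ℕtoℚ-homo-^ m (suc n) = trans (ℕtoℚ-homo-* m (m ^ n)) (cong (ℕtoℚ m ℚ.*_) (ℕtoℚ-homo-^ m n))

β-scaled : ∀ d t M → M + d ≡ suc d * suc d ^ (t + 1) →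
           ℕtoℚ (suc d ^ (t + 1)) ℚ.* β (suc d) t ≡ ℕtoℚ M
β-scaled d t M M+d≡kK = begin
  κ ℚ.* (k ℚ.- δ ℚ.* ι)
    ≡⟨ solve 4 (λ κ k δ ι → κ :* (k :- δ :* ι) := k :* κ :- δ :* (κ :* ι)) refl κ k δ ι ⟩
  k ℚ.* κ ℚ.- δ ℚ.* (κ ℚ.* ι)
    ≡⟨ cong₂ (λ x y → x ℚ.- δ ℚ.* y) kκ≡M+δ (ℕtoℚ-*-1/ K) ⟩
  ℕtoℚ M ℚ.+ δ ℚ.- δ ℚ.* 1ℚ
    ≡⟨ solve 2 (λ M δ → M :+ δ :- δ :* con 1ℚ := M) refl (ℕtoℚ M) δ ⟩
  ℕtoℚ M ∎
  where
  open ≡-Reasoning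
  K = suc d ^ (t + 1)
  instance _ = m^n≢0 (suc d) (t + 1)
  κ = ℕtoℚ K
  k = ℕtoℚ (suc d)
  δ = ℕtoℚ d
  ι = invPow (suc d) (t + 1)
  kκ≡M+δ : k ℚ.* κ ≡ ℕtoℚ M ℚ.+ δ
  kκ≡M+δ = trans (sym (ℕtoℚ-homo-* (suc d) K)) (trans (cong ℕtoℚ (sym M+d≡kK)) (ℕtoℚ-homo-+ M d))

≤-^ℚ : ∀ {a K M} n {β} .{{_ : NonZero K}} → ℕtoℚ K ℚ.* β ≡ ℕtoℚ M →
       a * K ^ n ≤ M ^ n → ℕtoℚ a ≤ℚ β ^ℚ n
≤-^ℚ {a} {K} {M} n {β} Kβ≡M aKⁿ≤Mⁿ = *-cancelʳ-≤-pos (ℕtoℚ (K ^ n)) (begin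
  ℕtoℚ a ℚ.* ℕtoℚ (K ^ n)    ≡⟨ sym (ℕtoℚ-homo-* a (K ^ n)) ⟩
  ℕtoℚ (a * K ^ n)           ≤⟨ ℕtoℚ-mono-≤ aKⁿ≤Mⁿ ⟩
  ℕtoℚ (M ^ n)               ≡⟨ ℕtoℚ-homo-^ M n ⟩
  ℕtoℚ M ^ℚ n                ≡⟨ cong (_^ℚ n) (sym Kβ≡M) ⟩
  (ℕtoℚ K ℚ.* β) ^ℚ n        ≡⟨ ^ℚ-distrib-* (ℕtoℚ K) β n ⟩
  ℕtoℚ K ^ℚ n ℚ.* β ^ℚ n     ≡⟨ cong (ℚ._* β ^ℚ n) (sym (ℕtoℚ-homo-^ K n)) ⟩
  ℕtoℚ (K ^ n) ℚ.* β ^ℚ n    ≡⟨ ℚ.*-comm (ℕtoℚ (K ^ n)) (β ^ℚ n) ⟩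
  β ^ℚ n ℚ.* ℕtoℚ (K ^ n)    ∎)
  where
  open ℚ.≤-Reasoning
  instance
    _ : NonZero (K ^ n)
    _ = m^n≢0 K n
    _ : Positive (ℕtoℚ (K ^ n))
    _ = normalize-pos (K ^ n) 1

zeros-++-0∷ : ∀ s (w : List ℕ) → zeros s ++ 0 ∷ w ≡ zeros (suc s) ++ w
zeros-++-0∷ zero    w = refl
zeros-++-0∷ (suc s) w = cong (0 ∷_) (zeros-++-0∷ s w)

Avoids : ℕ → List ℕ → Set
Avoids t w = ¬ Infix _≡_ (zeros t) w

AvoidsAfter : ℕ → ℕ → List ℕ → Set
AvoidsAfter t s w = Avoids t (zeros s ++ w)

avoidsAfter? : ∀ t s → Decidable (AvoidsAfter t s)
avoidsAfter? t s w = ¬? (infix? _≟_ (zeros t) (zeros s ++ w))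

zeros-infix-++ : ∀ {t s} (w : List ℕ) → t ≤ s → Infix _≡_ (zeros t) (zeros s ++ w)
zeros-infix-++ w t≤s = Infix.replicate⁺ t≤s refl ⁱ++ w

zeros-not-infix : ∀ {t s} → s < t → Avoids t (zeros s)
zeros-not-infix {t} {s} s<t inf =
  <⇒≱ s<t (subst₂ _≤_ (length-replicate t) (length-replicate s) (Infix.length-mono inf))

zeros-prefix⇒0≡a : ∀ {t s a} {w : List ℕ} → s < t → Prefix _≡_ (zeros t) (zeros s ++ a ∷ w) → 0 ≡ a
zeros-prefix⇒0≡a {s = zero}  (s≤s _)   (0≡a ∷ _) = 0≡a
zeros-prefix⇒0≡a {s = suc s} (s≤s s<t) (_ ∷ p)   = zeros-prefix⇒0≡a s<t p

zeros-infix-skips-nonzero : ∀ {t s a} {w : List ℕ} → s < t → a ≢ 0 →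
                          Infix _≡_ (zeros t) (zeros s ++ a ∷ w) → Infix _≡_ (zeros t) w
zeros-infix-skips-nonzero {s = zero}  s<t a≢0 (here p)    = contradiction (sym (zeros-prefix⇒0≡a s<t p)) a≢0
zeros-infix-skips-nonzero {s = zero}  s<t a≢0 (there inf) = inf
zeros-infix-skips-nonzero {s = suc s} s<t a≢0 (here p)    = contradiction (sym (zeros-prefix⇒0≡a s<t p)) a≢0
zeros-infix-skips-nonzero {s = suc s} s<t a≢0 (there inf) = zeros-infix-skips-nonzero (<⇒≤ s<t) a≢0 inf

-- avoiding k t 0 m is A k m (zeros t) by definition, which is used silently below.
avoiding : (k t s m : ℕ) → ℕ
avoiding k t s m = length (filter (avoidsAfter? t s) (allWords k m))

containing : (k t m : ℕ) → ℕ
containing k t m = length (filter (infix? _≟_ (zeros t)) (allWords k m))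

A+containing : ∀ k t m → A k m (zeros t) + containing k t m ≡ k ^ m
A+containing k t m =
  trans (length-filter-¬?+length-filter (infix? _≟_ (zeros t)) (allWords k m)) (length-allWords k m)

avoiding-run : ∀ k t m → avoiding k t t m ≡ 0
avoiding-run k t m =
  cong length (filter-none (avoidsAfter? t t) {allWords k m} (universal contains _))
  where
  contains : ∀ w → ¬ AvoidsAfter t t w
  contains w avoids = avoids (zeros-infix-++ w ≤-refl)

avoiding-[] : ∀ k {t s} → s < t → avoiding k t s 0 ≡ 1
avoiding-[] k {t} {s} s<t =
  cong length (filter-accept (avoidsAfter? t s) {xs = []} avoids)
  where
  avoids : AvoidsAfter t s []
  avoids = subst (Avoids t) (sym (++-identityʳ (zeros s))) (zeros-not-infix s<t)

avoiding-step : ∀ d {t s} m → s < t →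
  avoiding (suc d) t s (suc m) ≡ avoiding (suc d) t (suc s) m + d * avoiding (suc d) t 0 m
avoiding-step d {t} {s} m s<t = begin
  avoiding (suc d) t s (suc m)
    ≡⟨ length-filter-++ P? (map (0 ∷_) W) (concatMap prepend (applyUpTo suc d)) ⟩
  length (filter P? (map (0 ∷_) W)) + length (filter P? (concatMap prepend (applyUpTo suc d)))
    ≡⟨ cong (length (filter P? (map (0 ∷_) W)) +_) (cong length (filter-concatMap P? prepend (applyUpTo suc d))) ⟩
  length (filter P? (map (0 ∷_) W)) + length (concatMap (filter P? ∘ prepend) (applyUpTo suc d))
    ≡⟨ cong₂ _+_ (count-after 0 ((λ {w} → subst (Avoids t) (zeros-++-0∷ s w))
                               , (λ {w} → subst (Avoids t) (sym (zeros-++-0∷ s w)))))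
                 (length-concatMap-applyUpTo (filter P? ∘ prepend) suc _ nonzero-letter d) ⟩
  avoiding (suc d) t (suc s) m + d * avoiding (suc d) t 0 m ∎
  where
  open ≡-Reasoning
  P? = avoidsAfter? t s
  W  = allWords (suc d) m
  prepend : ℕ → List (List ℕ)
  prepend a = map (a ∷_) W
  count-after : ∀ a {s′} → (λ w → AvoidsAfter t s (a ∷ w)) ≐ AvoidsAfter t s′ →
                length (filter P? (prepend a)) ≡ avoiding (suc d) t s′ m
  count-after a {s′} same =
    trans (length-filter-map P? (a ∷_) W) (cong length (filter-≐ _ (avoidsAfter? t s′) same W))
  nonzero-letter : ∀ b → length (filter P? (prepend (suc b))) ≡ avoiding (suc d) t 0 m
  nonzero-letter b = count-after (suc b) ((λ avoids inf → avoids (zeros s ++ⁱ there inf))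
                                        , (λ avoids inf → avoids (zeros-infix-skips-nonzero s<t (λ ()) inf)))

module _ (d t : ℕ) where

  private
    k : ℕ
    k = suc d

    a : ℕ → ℕ
    a m = A k m (zeros t)

    b : ℕ → ℕ
    b m = containing k t m

  avoiding-short : ∀ j s → j + s < t → avoiding k t s j ≡ k ^ j
  avoiding-short zero    s s<t   = avoiding-[] k s<t
  avoiding-short (suc j) s j+s<t = begin
    avoiding k t s (suc j)                            ≡⟨ avoiding-step d j (m+n≤o⇒n≤o j (<⇒≤ j+s+1<t)) ⟩
    avoiding k t (suc s) j + d * avoiding k t 0 j      ≡⟨ cong₂ (λ x y → x + d * y) (avoiding-short j (suc s) j+s+1<t)
                                                                                 (avoiding-short j 0 j+0<t) ⟩
    k ^ j + d * k ^ j                                  ∎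
    where
    open ≡-Reasoning
    j+s+1<t : j + suc s < t
    j+s+1<t = subst (_< t) (sym (+-suc j s)) j+s<t
    j+0<t : j + 0 < t
    j+0<t = subst (_< t) (sym (+-identityʳ j)) (m+n≤o⇒m≤o (suc j) (<⇒≤ j+s<t))

  A-short : ∀ m → m < t → a m ≡ k ^ m
  A-short m m<t = avoiding-short m 0 (subst (_< t) (sym (+-identityʳ m)) m<t)

  avoiding-last : ∀ j s → s + j ≡ t → avoiding k t s j + 1 ≡ k ^ j
  avoiding-last zero    s s+0≡t rewrite trans (sym (+-identityʳ s)) s+0≡t = cong (_+ 1) (avoiding-run k t 0)
  avoiding-last (suc j) s s+j+1≡t = begin
    avoiding k t s (suc j) + 1            ≡⟨ cong (_+ 1) (avoiding-step d j s<t) ⟩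
    avoiding k t (suc s) j + d * a j + 1  ≡⟨ xy∙z≈xz∙y _ (d * a j) 1 ⟩
    avoiding k t (suc s) j + 1 + d * a j  ≡⟨ cong₂ (λ x y → x + d * y) (avoiding-last j (suc s) s+1+j≡t) (A-short j j<t) ⟩
    k ^ j + d * k ^ j                     ∎
    where
    open ≡-Reasoning
    s+1+j≡t : suc s + j ≡ t
    s+1+j≡t = trans (sym (+-suc s j)) s+j+1≡t
    s<t : s < t
    s<t = subst (s <_) s+j+1≡t (m<m+n s z<s)
    j<t : j < t
    j<t = subst (j <_) s+j+1≡t (m≤n+m (suc j) s)

  -- A-step is the case s = 0; the induction runs over the distance j = t − s to a full run.
  avoiding-shift : ∀ j s → s + j ≡ t → ∀ m →
                   avoiding k t s (suc m + j) + d * a m ≡ avoiding k t s (m + j) + d * a (m + j)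
  avoiding-shift zero s s+0≡t m rewrite +-identityʳ m | trans (sym (+-identityʳ s)) s+0≡t =
    cong (_+ d * a m) (trans (avoiding-run k t (suc m)) (sym (avoiding-run k t m)))
  avoiding-shift (suc j) s s+j+1≡t m = begin
    avoiding k t s (suc m + suc j) + d * a m
      ≡⟨ cong (λ x → avoiding k t s x + d * a m) (+-suc (suc m) j) ⟩
    avoiding k t s (suc (suc m + j)) + d * a m
      ≡⟨ cong (_+ d * a m) (avoiding-step d (suc m + j) s<t) ⟩
    avoiding k t (suc s) (suc m + j) + d * a (suc m + j) + d * a m
      ≡⟨ xy∙z≈xz∙y _ (d * a (suc m + j)) (d * a m) ⟩
    avoiding k t (suc s) (suc m + j) + d * a m + d * a (suc m + j)
      ≡⟨ cong₂ _+_ (avoiding-shift j (suc s) s+1+j≡t m) (cong (λ x → d * a x) (sym (+-suc m j))) ⟩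
    avoiding k t (suc s) (m + j) + d * a (m + j) + d * a (m + suc j)
      ≡⟨ cong (_+ d * a (m + suc j)) (sym (avoiding-step d (m + j) s<t)) ⟩
    avoiding k t s (suc (m + j)) + d * a (m + suc j)
      ≡⟨ cong (λ x → avoiding k t s x + d * a (m + suc j)) (sym (+-suc m j)) ⟩
    avoiding k t s (m + suc j) + d * a (m + suc j) ∎
    where
    open ≡-Reasoning
    s+1+j≡t : suc s + j ≡ t
    s+1+j≡t = trans (sym (+-suc s j)) s+j+1≡t
    s<t : s < t
    s<t = subst (s <_) s+j+1≡t (m<m+n s z<s)

  A-step : ∀ m → a (suc m + t) + d * a m ≡ k * a (m + t)
  A-step m = avoiding-shift t 0 refl m

  A≤^ : ∀ m → a m ≤ k ^ m
  A≤^ m = subst (a m ≤_) (A+containing k t m) (m≤m+n (a m) (b m))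

  containing-t≡1 : b t ≡ 1
  containing-t≡1 = +-cancelˡ-≡ (a t) (b t) 1 (trans (A+containing k t t) (sym (avoiding-last t 0 refl)))

  containing-step : ∀ m → b (suc m + t) ≡ k * b (m + t) + d * a m
  containing-step m = +-cancelˡ-≡ (a (suc m + t)) _ _ (begin
    a (suc m + t) + b (suc m + t)              ≡⟨ A+containing k t (suc m + t) ⟩
    k * k ^ (m + t)                            ≡⟨ cong (k *_) (sym (A+containing k t (m + t))) ⟩
    k * (a (m + t) + b (m + t))                ≡⟨ *-distribˡ-+ k (a (m + t)) (b (m + t)) ⟩
    k * a (m + t) + k * b (m + t)              ≡⟨ cong (_+ k * b (m + t)) (sym (A-step m)) ⟩
    a (suc m + t) + d * a m + k * b (m + t)    ≡⟨ xy∙z≈x∙zy (a (suc m + t)) (d * a m) (k * b (m + t)) ⟩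
    a (suc m + t) + (k * b (m + t) + d * a m)  ∎)
    where open ≡-Reasoning

  containing-≤ : ∀ l → b (l + t) ≤ suc l * k ^ l
  containing-≤ zero    = ≤-reflexive containing-t≡1
  containing-≤ (suc l) = begin
    b (suc l + t)                   ≡⟨ containing-step l ⟩
    k * b (l + t) + d * a l         ≤⟨ +-mono-≤ (*-monoʳ-≤ k (containing-≤ l)) (*-mono-≤ (n≤1+n d) (A≤^ l)) ⟩
    k * (suc l * k ^ l) + k * k ^ l ≡⟨ regroup k l (k ^ l) ⟩
    suc (suc l) * k ^ suc l         ∎
    where
    open ≤-Reasoning
    regroup : ∀ k l p → k * (suc l * p) + k * p ≡ suc (suc l) * (k * p)
    regroup = solve-∀

  A-large : 2 ≤ k → ∀ i → i < t → k ^ (i + t) ≤ k * a (i + t)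
  A-large 2≤k i i<t = +-cancelʳ-≤ (k * b (i + t)) _ _ (begin
    k ^ (i + t) + k * b (i + t)    ≤⟨ +-monoʳ-≤ (k ^ (i + t)) k*b≤ ⟩
    k ^ (i + t) + d * k ^ (i + t)  ≡⟨ cong (k *_) (sym (A+containing k t (i + t))) ⟩
    k * (a (i + t) + b (i + t))    ≡⟨ *-distribˡ-+ k (a (i + t)) (b (i + t)) ⟩
    k * a (i + t) + k * b (i + t)  ∎)
    where
    open ≤-Reasoning
    instance
      _ : NonZero d
      _ = >-nonZero (s≤s⁻¹ 2≤k)
    xyz-rot : ∀ x y z → x * (y * z) ≡ y * x * z
    xyz-rot = solve-∀
    xyz-swap : ∀ x y z → x * y * z ≡ x * (z * y)
    xyz-swap = solve-∀
    k*b≤ : k * b (i + t) ≤ d * k ^ (i + t)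
    k*b≤ = begin
      k * b (i + t)          ≤⟨ *-monoʳ-≤ k (containing-≤ i) ⟩
      k * (suc i * k ^ i)    ≡⟨ xyz-rot k (suc i) (k ^ i) ⟩
      suc i * k * k ^ i      ≤⟨ *-monoˡ-≤ (k ^ i) (*-monoˡ-≤ k i<t) ⟩
      t * k * k ^ i          ≤⟨ *-monoˡ-≤ (k ^ i) (n*m≤m^n 2≤k t) ⟩
      k ^ t * k ^ i          ≤⟨ *-monoˡ-≤ (k ^ i) (m≤n*m (k ^ t) d) ⟩
      d * k ^ t * k ^ i      ≡⟨ xyz-swap d (k ^ t) (k ^ i) ⟩
      d * (k ^ i * k ^ t)    ≡⟨ cong (d *_) (sym (^-distribˡ-+-* k i t)) ⟩
      d * k ^ (i + t)        ∎

  containing-first-window : ∀ l → l ≤ t → l * d * k ^ l ≤ k * b (l + t)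
  containing-first-window l l≤t =
    ≤-trans (m≤n+m _ _) (linear-growth (λ l → k * b (l + t)) k d t step l l≤t)
    where
    open ≡-Reasoning
    factor : ∀ k B d x → k * (k * B) + d * (k * x) ≡ k * (k * B + d * x)
    factor = solve-∀
    step : ∀ l → l < t → k * (k * b (l + t)) + d * k ^ suc l ≤ k * b (suc l + t)
    step l l<t = ≤-reflexive (begin
      k * (k * b (l + t)) + d * (k * k ^ l)  ≡⟨ cong (λ x → k * (k * b (l + t)) + d * (k * x)) (sym (A-short l l<t)) ⟩
      k * (k * b (l + t)) + d * (k * a l)    ≡⟨ factor k (b (l + t)) d (a l) ⟩
      k * (k * b (l + t) + d * a l)          ≡⟨ cong (k *_) (sym (containing-step l)) ⟩
      k * b (suc l + t)                      ∎)

  containing-second-window : 2 ≤ k → ∀ i → i ≤ t → (i + t + t) * d * k ^ (i + t) ≤ k * (k * b (i + t + t))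
  containing-second-window 2≤k i i≤t = begin
    (i + t + t) * d * k ^ (i + t)                  ≡⟨ cong ((i + t + t) * d *_) (^-distribˡ-+-* k i t) ⟩
    (i + t + t) * d * (k ^ i * k ^ t)              ≡⟨ split i t d (k ^ i) (k ^ t) ⟩
    k ^ i * (2 * (t * d * k ^ t)) + i * c * k ^ i  ≤⟨ +-monoˡ-≤ (i * c * k ^ i) (*-monoʳ-≤ (k ^ i) initial) ⟩
    k ^ i * x 0 + i * c * k ^ i                    ≤⟨ linear-growth x k c t step i i≤t ⟩
    x i                                            ∎
    where
    open ≤-Reasoning
    c = d * k ^ t
    x : ℕ → ℕ
    x i = k * (k * b (i + t + t))
    initial : 2 * (t * d * k ^ t) ≤ x 0
    initial = *-mono-≤ 2≤k (containing-first-window t ≤-refl)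
    split : ∀ i t d p q → (i + t + t) * d * (p * q) ≡ p * (2 * (t * d * q)) + i * (d * q) * p
    split = solve-∀
    rearrange : ∀ d q k p → d * q * (k * p) ≡ k * (d * (p * q))
    rearrange = solve-∀
    factor : ∀ k B d y → k * (k * (k * B)) + k * (d * (k * y)) ≡ k * (k * (k * B + d * y))
    factor = solve-∀
    step : ∀ i → i < t → k * x i + c * k ^ suc i ≤ x (suc i)
    step i i<t = begin
      k * x i + d * k ^ t * (k * k ^ i)
        ≡⟨ cong (k * x i +_) (rearrange d (k ^ t) k (k ^ i)) ⟩
      k * x i + k * (d * (k ^ i * k ^ t))
        ≡⟨ cong (λ y → k * x i + k * (d * y)) (sym (^-distribˡ-+-* k i t)) ⟩
      k * x i + k * (d * k ^ (i + t))
        ≤⟨ +-monoʳ-≤ (k * x i) (*-monoʳ-≤ k (*-monoʳ-≤ d (A-large 2≤k i i<t))) ⟩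
      k * (k * (k * b (i + t + t))) + k * (d * (k * a (i + t)))
        ≡⟨ factor k (b (i + t + t)) d (a (i + t)) ⟩
      k * (k * (k * b (i + t + t) + d * a (i + t)))
        ≡⟨ cong (λ y → k * (k * y)) (sym (containing-step (i + t))) ⟩
      x (suc i) ∎

  containing-deficit : 2 ≤ k → ∀ i → i ≤ t →
                       (i + t + t) * d * k ^ (i + t + t) ≤ b (i + t + t) * (k * k ^ (t + 1))
  containing-deficit 2≤k i i≤t = begin
    n * d * k ^ (i + t + t)               ≡⟨ cong (n * d *_) (^-distribˡ-+-* k (i + t) t) ⟩
    n * d * (k ^ (i + t) * k ^ t)         ≡⟨ sym (*-assoc (n * d) (k ^ (i + t)) (k ^ t)) ⟩
    n * d * k ^ (i + t) * k ^ t           ≤⟨ *-monoˡ-≤ (k ^ t) (containing-second-window 2≤k i i≤t) ⟩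
    k * (k * b n) * k ^ t                 ≡⟨ rearrange k (b n) (k ^ t) ⟩
    b n * (k * (k ^ t * k ^ 1))           ≡⟨ cong (λ y → b n * (k * y)) (sym (^-distribˡ-+-* k t 1)) ⟩
    b n * (k * k ^ (t + 1))               ∎
    where
    open ≤-Reasoning
    n = i + t + t
    rearrange : ∀ k B q → k * (k * B) * q ≡ B * (k * (q * (k * 1)))
    rearrange = solve-∀


lemma14 : (k t n : ℕ) → 2 ≤ k → 2 ≤ t → 2 * t ≤ n → n ≤ 3 * t →
          ℕtoℚ (A k n (zeros t)) ≤ℚ (β k t ^ℚ n)
lemma14 k@(suc (suc d)) t n 2≤k@(s≤s (s≤s _)) _ 2t≤n n≤3t =
  subst (λ n → ℕtoℚ (A k n (zeros t)) ≤ℚ (β k t ^ℚ n)) i+t+t≡n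
    (≤-^ℚ {a} {K} {M} (i + t + t) (β-scaled (suc d) t M M+d≡kK) a*Kⁿ≤Mⁿ)
  where
  i = n ∸ (t + t)
  a = A k (i + t + t) (zeros t)
  K = k ^ (t + 1)
  M = k * K ∸ suc d
  instance _ = m^n≢0 k (t + 1)
  t+t≤n : t + t ≤ n
  t+t≤n = subst (_≤ n) (cong (t +_) (+-identityʳ t)) 2t≤n
  i+t+t≡n : i + t + t ≡ n
  i+t+t≡n = trans (+-assoc i t t) (m∸n+n≡m t+t≤n)
  3*t≡t+t+t : 3 * t ≡ t + t + t
  3*t≡t+t+t = trans (cong (λ u → t + (t + u)) (+-identityʳ t)) (sym (+-assoc t t t))
  i≤t : i ≤ t
  i≤t = ≤-trans (∸-monoˡ-≤ (t + t) n≤3t)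
                (≤-reflexive (trans (cong (_∸ (t + t)) 3*t≡t+t+t) (m+n∸m≡n (t + t) t)))
  M+d≡kK : M + suc d ≡ k * K
  M+d≡kK = m∸n+n≡m (≤-trans (n≤1+n (suc d)) (m≤m*n k K))
  a*Kⁿ≤Mⁿ : a * K ^ (i + t + t) ≤ M ^ (i + t + t)
  a*Kⁿ≤Mⁿ = power-bound {a} {containing k t (i + t + t)} (i + t + t) (A+containing k t (i + t + t)) M+d≡kK
                        (containing-deficit (suc d) t 2≤k i i≤t)
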